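{- Let $C$ be a doubly even self-dual binary linear code of length $N$ with code-lattice $L$, let $\bar g\in\operatorname{Aut}C$ have order $2$, and let $g=\iota(\bar g)$. Then $|B\cap\bar g(B)|\equiv0\pmod4$ for all codewords $B\in C$ (viewed as subsets of $\{1,\dots,N\}$) if and only if $\langle\alpha,g\alpha\rangle\in2\mathbb{Z}$ for all $\alpha\in L$.
   Context: Code-lattice: with $\langle\beta_i,\beta_j\rangle=\tfrac12\delta_{ij}$, $L=\{\sum_ia_i\beta_i:a_i\in\mathbb{Z},(a_i\bmod2)_i\in C\}$, and $\iota(\sigma)(\beta_j)=\beta_{\sigma(j)}$, so $\iota(\operatorname{Aut}C)\subseteq\operatorname{Aut}L$. -}

module Defs where

open import Level using (0ℓ)
open import Data.Nat using (ℕ; zero; suc; _%_)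
import Data.Nat as ℕ
open import Data.Bool using (Bool; true; false; _xor_)
open import Data.Fin using (Fin; zero; suc)
open import Data.Fin.Subset using (Subset; ⊥; _∩_; ∣_∣)
open import Data.Fin.Permutation using (Permutation′; _⟨$⟩ʳ_; _⟨$⟩ˡ_)
open import Data.Vec using (Vec; tabulate; lookup; zipWith)
open import Data.Integer using (ℤ; +_; _+_; _*_)
import Data.Integer as ℤ
open import Data.Integer.Divisibility using (_∣_)
open import Data.Product using (_×_; ∃)
open import Relation.Unary using (Pred; _∈_)
open import Relation.Binary.PropositionalEquality using (_≡_; _≢_)
open import Relation.Nullary using (does)
open import Function.Bundles using (_⇔_)
open import Function.Base using (id)

-- Binary words of length N are identified with subsets of {1,…,N} (Fin N).
-- A binary code of length N is a predicate on such subsets.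
Code : ℕ → Set₁
Code N = Pred (Subset N) 0ℓ

_△_ : ∀ {N} → Subset N → Subset N → Subset N
_△_ = zipWith _xor_

IsLinear : ∀ {N} → Code N → Set
IsLinear C = (⊥ ∈ C) × (∀ x y → x ∈ C → y ∈ C → (x △ y) ∈ C)

Orthogonal : ∀ {N} → Subset N → Subset N → Set
Orthogonal x y = ∣ x ∩ y ∣ % 2 ≡ 0

_⊥' : ∀ {N} → Code N → Code N
(C ⊥') x = ∀ y → y ∈ C → Orthogonal x y

IsSelfDual : ∀ {N} → Code N → Set
IsSelfDual C = ∀ x → (x ∈ C) ⇔ (x ∈ (C ⊥'))

IsDoublyEven : ∀ {N} → Code N → Set
IsDoublyEven C = ∀ x → x ∈ C → ∣ x ∣ % 4 ≡ 0

-- action of a permutation σ on subsets: σ(B) = { σ j | j ∈ B }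
act : ∀ {N} → Permutation′ N → Subset N → Subset N
act σ B = tabulate (λ k → lookup B (σ ⟨$⟩ˡ k))

IsAut : ∀ {N} → Code N → Permutation′ N → Set
IsAut C σ = ∀ B → (B ∈ C) ⇔ (act σ B ∈ C)

HasOrder2 : ∀ {N} → Permutation′ N → Set
HasOrder2 {N} σ = (∀ i → σ ⟨$⟩ʳ (σ ⟨$⟩ʳ i) ≡ i) × (∃ λ i → σ ⟨$⟩ʳ i ≢ i)

-- Lattice vectors α = Σ a_i β_i are given by their coordinate vectors a : Fin N → ℤ.
Coords : ℕ → Set
Coords N = Fin N → ℤ

red : ∀ {N} → Coords N → Subset N
red a = tabulate (λ i → does ((ℤ.∣ a i ∣ % 2) ℕ.≟ 1))

InLattice : ∀ {N} → Code N → Coords N → Set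
InLattice C a = red a ∈ C

-- ι(σ)(β_j) = β_{σ j}, so ι(σ)(Σ a_i β_i) = Σ_j a_{σ⁻¹ j} β_j
ι : ∀ {N} → Permutation′ N → Coords N → Coords N
ι σ a j = a (σ ⟨$⟩ˡ j)

sumℤ : ∀ {N} → (Fin N → ℤ) → ℤ
sumℤ {zero}  f = + 0
sumℤ {suc N} f = f zero + sumℤ (λ i → f (suc i))

-- Since ⟨β_i,β_j⟩ = ½ δ_ij, we have 2⟨α,α'⟩ = Σ_i a_i a'_i ∈ ℤ.
-- twiceInner a a' is 2⟨α,α'⟩.
twiceInner : ∀ {N} → Coords N → Coords N → ℤ
twiceInner a a' = sumℤ (λ i → a i * a' i)

-- ⟨α,α'⟩ ∈ 2ℤ  ⇔  2⟨α,α'⟩ ∈ 4ℤ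
InnerIn2ℤ : ∀ {N} → Coords N → Coords N → Set
InnerIn2ℤ a a' = (+ 4) ∣ twiceInner a a'

{-# OPTIONS --safe #-}
module Submission where

-- Write each coordinate as a = χ(a mod 2) + 2c. Then a_i a_{σi} ≡ χ_i χ_{σi} + 2(χ_i c_{σi} + c_i χ_{σi})
-- modulo 4, and since σ is an involution the two halves of the cross term have the same sum
-- (reindex i ↦ σ i), so the cross term contributes a multiple of 4. Hence 2⟨α, gα⟩ ≡ |B ∩ σ(B)| (mod 4)
-- for B the reduction of α mod 2, and every subset B arises as such a reduction, namely of its indicator.

open import Defs
open import Data.Nat using (ℕ; _%_)
open import Data.Fin.Subset using (Subset; _∩_; ∣_∣)
open import Data.Fin.Permutation using (Permutation′)
open import Relation.Binary.PropositionalEquality using (_≡_)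
open import Function.Bundles using (_⇔_)

import Data.Nat as ℕ
import Data.Nat.Divisibility as ℕ
open import Data.Nat using (zero; suc)
open import Data.Bool using (Bool; true; false; _∧_)
open import Data.Fin using (Fin; zero; suc)
open import Data.Fin.Permutation using (_⟨$⟩ʳ_; _⟨$⟩ˡ_; inverseˡ)
open import Data.Vec using ([]; _∷_; lookup)
open import Data.Vec.Properties using (lookup∘tabulate; tabulate∘lookup; tabulate-cong; lookup-zipWith)
open import Data.Integer using (ℤ; +_; -[1+_]; _+_; _*_; -_; _-_)
import Data.Integer as ℤ
open import Data.Integer.Divisibility using (_∣_)
import Data.Integer.Divisibility.Signed as Signed
import Data.Integer.Properties as ℤ
open import Data.Integer.Solver using (module +-*-Solver)
open import Algebra.Properties.Semiring.Sum ℤ.+-*-semiring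
  using (sum; sum-cong-≗; ∑-distrib-+; *-distribˡ-sum; sum-permute)
open import Data.Product using (∃; _,_; proj₁; proj₂)
open import Relation.Binary.PropositionalEquality using (refl; sym; trans; cong; cong₂; subst; module ≡-Reasoning)
open import Relation.Nullary using (does)
open import Function.Bundles using (mk⇔; Equivalence)
open +-*-Solver using (solve; _:+_; _:*_; :-_; _:=_; con)

χ : Bool → ℤ
χ true  = + 1
χ false = + 0

χ-∧ : ∀ u v → χ (u ∧ v) ≡ χ u * χ v
χ-∧ true  true  = refl
χ-∧ true  false = refl
χ-∧ false v     = refl

odd : ℤ → Bool
odd x = does ((ℤ.∣ x ∣ % 2) ℕ.≟ 1)

odd-χ : ∀ u → odd (χ u) ≡ u
odd-χ true  = refl
odd-χ false = refl

odd-decomposition⁺ : ∀ n → ∃ λ c → + n ≡ χ (odd (+ n)) + + 2 * c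
odd-decomposition⁺ 0 = + 0 , refl
odd-decomposition⁺ 1 = + 0 , refl
odd-decomposition⁺ (suc (suc n)) with odd-decomposition⁺ n
... | c , n≡ = c + + 1 , trans (cong (_+_ (+ 2)) n≡) (shift (χ (odd (+ n))) c)
  where
  shift : ∀ u c → + 2 + (u + + 2 * c) ≡ u + + 2 * (c + + 1)
  shift = solve 2 (λ u c → con (+ 2) :+ (u :+ con (+ 2) :* c) := u :+ con (+ 2) :* (c :+ con (+ 1))) refl

odd-decomposition : ∀ x → ∃ λ c → x ≡ χ (odd x) + + 2 * c
odd-decomposition (+ n) = odd-decomposition⁺ n
odd-decomposition -[1+ n ] with odd-decomposition⁺ (suc n)
... | c , n≡ = - c - u , trans (cong -_ n≡) (negate u c)
  where
  u = χ (odd (+ suc n))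
  negate : ∀ u c → - (u + + 2 * c) ≡ u + + 2 * (- c - u)
  negate = solve 2 (λ u c → :- (u :+ con (+ 2) :* c) := u :+ con (+ 2) :* (:- c :+ :- u)) refl

d∣x+d*k⇔d∣x : ∀ {d x} k → (d ∣ x + d * k) ⇔ (d ∣ x)
d∣x+d*k⇔d∣x {d} {x} k = mk⇔
  (λ d∣x+dk → Signed.∣⇒∣ᵤ (Signed.∣m+n∣n⇒∣m {d} {x} (Signed.∣ᵤ⇒∣ {d} {x + d * k} d∣x+dk) d∣dk))
  (λ d∣x → Signed.∣⇒∣ᵤ (Signed.∣m∣n⇒∣m+n (Signed.∣ᵤ⇒∣ {d} {x} d∣x) d∣dk))
  where
  d∣dk : d Signed.∣ d * k
  d∣dk = Signed.∣m⇒∣m*n k Signed.∣-refl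

sumℤ≡sum : ∀ {N} (f : Fin N → ℤ) → sumℤ f ≡ sum f
sumℤ≡sum {zero}  f = refl
sumℤ≡sum {suc N} f = cong (_+_ (f zero)) (sumℤ≡sum (λ i → f (suc i)))

∣p∣≡sum : ∀ {N} (p : Subset N) → + ∣ p ∣ ≡ sum (λ i → χ (lookup p i))
∣p∣≡sum []          = refl
∣p∣≡sum (true ∷ p)  = cong (_+_ (+ 1)) (∣p∣≡sum p)
∣p∣≡sum (false ∷ p) = trans (∣p∣≡sum p) (sym (ℤ.+-identityˡ _))

indicator : ∀ {N} → Subset N → Coords N
indicator B i = χ (lookup B i)

red-indicator : ∀ {N} (B : Subset N) → red (indicator B) ≡ B
red-indicator B = trans (tabulate-cong (λ i → odd-χ (lookup B i))) (tabulate∘lookup B)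

indicator-red-decomposition : ∀ {N} (a : Coords N) →
  ∃ λ c → ∀ i → a i ≡ indicator (red a) i + + 2 * c i
indicator-red-decomposition a =
  (λ i → proj₁ (odd-decomposition (a i))) ,
  λ i → trans (proj₂ (odd-decomposition (a i)))
              (cong (λ u → χ u + _) (sym (lookup∘tabulate (λ j → odd (a j)) i)))

twiceInner-ι-indicator : ∀ {N} (σ : Permutation′ N) (B : Subset N) →
  twiceInner (indicator B) (ι σ (indicator B)) ≡ + ∣ B ∩ act σ B ∣
twiceInner-ι-indicator σ B = begin
  sumℤ (λ i → χ (lookup B i) * χ (lookup B (σ ⟨$⟩ˡ i)))
    ≡⟨ sumℤ≡sum (λ i → χ (lookup B i) * χ (lookup B (σ ⟨$⟩ˡ i))) ⟩
  sum (λ i → χ (lookup B i) * χ (lookup B (σ ⟨$⟩ˡ i)))   ≡⟨ sum-cong-≗ lookup-∩ ⟨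
  sum (λ i → χ (lookup (B ∩ act σ B) i))                 ≡⟨ ∣p∣≡sum (B ∩ act σ B) ⟨
  + ∣ B ∩ act σ B ∣                                      ∎
  where
  open ≡-Reasoning
  lookup-∩ : ∀ i → χ (lookup (B ∩ act σ B) i) ≡ χ (lookup B i) * χ (lookup B (σ ⟨$⟩ˡ i))
  lookup-∩ i = trans (cong χ (lookup-zipWith _∧_ i B (act σ B)))
    (trans (χ-∧ (lookup B i) _)
           (cong (λ u → χ (lookup B i) * χ u) (lookup∘tabulate (λ k → lookup B (σ ⟨$⟩ˡ k)) i)))

module Involution {N : ℕ} (σ : Permutation′ N) (σ²≡id : ∀ i → σ ⟨$⟩ʳ (σ ⟨$⟩ʳ i) ≡ i) where

  σ⁻¹≡σ : ∀ i → σ ⟨$⟩ˡ i ≡ σ ⟨$⟩ʳ i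
  σ⁻¹≡σ i = trans (cong (σ ⟨$⟩ˡ_) (sym (σ²≡id i))) (inverseˡ σ)

  sum-swap : (f : Fin N → Fin N → ℤ) → sum (λ i → f i (σ ⟨$⟩ˡ i)) ≡ sum (λ i → f (σ ⟨$⟩ˡ i) i)
  sum-swap f = trans (sum-permute (λ i → f i (σ ⟨$⟩ˡ i)) σ)
    (sum-cong-≗ (λ i → cong₂ f (sym (σ⁻¹≡σ i)) (inverseˡ σ)))

  twiceInner-ι-mod4 : ∀ (x y c : Coords N) → (∀ i → x i ≡ y i + + 2 * c i) →
    ∃ λ k → twiceInner x (ι σ x) ≡ twiceInner y (ι σ y) + + 4 * k
  twiceInner-ι-mod4 x y c x≡ = Q + T , (begin
    sumℤ (λ i → x i * x (s i))                                ≡⟨ sumℤ≡sum (λ i → x i * x (s i)) ⟩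
    sum (λ i → x i * x (s i))                                 ≡⟨ sum-cong-≗ expand ⟩
    sum (λ i → yy i + + 2 * (yc i + cy i) + + 4 * cc i)
      ≡⟨ ∑-distrib-+ (λ i → yy i + + 2 * (yc i + cy i)) (λ i → + 4 * cc i) ⟩
    sum (λ i → yy i + + 2 * (yc i + cy i)) + sum (λ i → + 4 * cc i)
      ≡⟨ cong₂ _+_ (∑-distrib-+ yy (λ i → + 2 * (yc i + cy i))) (sym (*-distribˡ-sum (+ 4) cc)) ⟩
    P + sum (λ i → + 2 * (yc i + cy i)) + + 4 * T
      ≡⟨ cong (λ z → P + z + + 4 * T)
              (trans (sym (*-distribˡ-sum (+ 2) (λ i → yc i + cy i))) (cong (_*_ (+ 2)) (∑-distrib-+ yc cy))) ⟩
    P + + 2 * (Q + sum cy) + + 4 * T                          ≡⟨ cong (λ z → P + + 2 * (Q + z) + + 4 * T) cross ⟩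
    P + + 2 * (Q + Q) + + 4 * T                               ≡⟨ collect P Q T ⟩
    P + + 4 * (Q + T)                                         ≡⟨ cong (λ z → z + + 4 * (Q + T)) (sumℤ≡sum yy) ⟨
    sumℤ (λ i → y i * y (s i)) + + 4 * (Q + T)                ∎)
    where
    open ≡-Reasoning
    s = σ ⟨$⟩ˡ_
    yy yc cy cc : Fin N → ℤ
    yy i = y i * y (s i)
    yc i = y i * c (s i)
    cy i = c i * y (s i)
    cc i = c i * c (s i)
    P = sum yy
    Q = sum yc
    T = sum cc
    expand : ∀ i → x i * x (s i) ≡ yy i + + 2 * (yc i + cy i) + + 4 * cc i
    expand i = trans (cong₂ _*_ (x≡ i) (x≡ (s i)))
      (solve 4 (λ u u' v v' → (u :+ con (+ 2) :* v) :* (u' :+ con (+ 2) :* v')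
                   := u :* u' :+ con (+ 2) :* (u :* v' :+ v :* u') :+ con (+ 4) :* (v :* v')) refl
             (y i) (y (s i)) (c i) (c (s i)))
    cross : sum cy ≡ Q
    cross = trans (sum-swap (λ i j → c i * y j)) (sum-cong-≗ (λ i → ℤ.*-comm (c (s i)) (y i)))
    collect : ∀ p q t → p + + 2 * (q + q) + + 4 * t ≡ p + + 4 * (q + t)
    collect = solve 3 (λ p q t → p :+ con (+ 2) :* (q :+ q) :+ con (+ 4) :* t
                                  := p :+ con (+ 4) :* (q :+ t)) refl

  twiceInner-ι≡card-mod4 : ∀ (a : Coords N) →
    ∃ λ k → twiceInner a (ι σ a) ≡ + ∣ red a ∩ act σ (red a) ∣ + + 4 * k
  twiceInner-ι≡card-mod4 a with indicator-red-decomposition a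
  ... | c , a≡ with twiceInner-ι-mod4 a (indicator (red a)) c a≡
  ... | k , eq = k , trans eq (cong (λ z → z + + 4 * k) (twiceInner-ι-indicator σ (red a)))

lemma8p5 : (N : ℕ) (C : Code N) → IsLinear C → IsSelfDual C → IsDoublyEven C →
    (σ : Permutation′ N) → IsAut C σ → HasOrder2 σ →
    (∀ (B : Subset N) → C B → ∣ B ∩ act σ B ∣ % 4 ≡ 0)
    ⇔ (∀ (a : Coords N) → InLattice C a → InnerIn2ℤ a (ι σ a))
lemma8p5 N C _ _ _ σ _ (σ²≡id , _) = mk⇔ to from
  where
  open Involution σ σ²≡id
  to : (∀ B → C B → ∣ B ∩ act σ B ∣ % 4 ≡ 0) → ∀ a → InLattice C a → InnerIn2ℤ a (ι σ a)
  to h a a∈L with twiceInner-ι≡card-mod4 a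
  ... | k , eq = subst (+ 4 ∣_) (sym eq)
    (Equivalence.from (d∣x+d*k⇔d∣x {+ 4} {+ ∣ red a ∩ act σ (red a) ∣} k)
                      (ℕ.m%n≡0⇒n∣m _ 4 (h (red a) a∈L)))
  from : (∀ a → InLattice C a → InnerIn2ℤ a (ι σ a)) → ∀ B → C B → ∣ B ∩ act σ B ∣ % 4 ≡ 0
  from h B B∈C = ℕ.n∣m⇒m%n≡0 _ 4 (subst (+ 4 ∣_) (twiceInner-ι-indicator σ B)
    (h (indicator B) (subst C (sym (red-indicator B)) B∈C)))
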